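{- Let $p$ be a non-empty word that is a palindrome, rich and square-free. Then $|p|$ is odd, and the middle letter of $p$ (the letter at position $(|p|+1)/2$) occurs exactly once in $p$.
   Context: A palindrome is a word equal to its reversal. A word $w$ is rich if it has exactly $|w|+1$ distinct palindromic factors, counting the empty word. A word is square-free if it has no factor $uu$ with $u$ non-empty. -}

module Defs where

open import Data.List using (List; []; _++_; reverse; length)
open import Data.List.Membership.Propositional using (_∈_)
open import Data.List.Relation.Unary.All using (All)
open import Data.List.Relation.Unary.Unique.Propositional using (Unique)
open import Data.Nat using (ℕ; suc)
open import Data.Product using (Σ; ∃₂; _×_)
open import Relation.Binary.PropositionalEquality using (_≡_)

module _ {A : Set} where

  Palindrome : List A → Set
  Palindrome w = reverse w ≡ w

  Factor : List A → List A → Set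
  Factor f w = ∃₂ λ u v → u ++ (f ++ v) ≡ w

  -- w has exactly |w|+1 distinct palindromic factors (the empty word included):
  -- there is a duplicate-free list enumerating exactly the palindromic factors of w,
  -- and its length is |w| + 1
  Rich : List A → Set
  Rich w = Σ (List (List A)) λ L →
             Unique L
           × All (λ f → Factor f w × Palindrome f) L
           × (∀ f → Factor f w → Palindrome f → f ∈ L)
           × length L ≡ suc (length w)

  SquareFree : List A → Set
  SquareFree w = ∀ u → Factor (u ++ u) w → u ≡ []

module Submission where

-- A palindrome of even length 2k > 0 has the square aa at its
-- centre, so a square-free palindrome p has odd length and can be written
-- p = reverse R ++ c ∷ R with |R| = k.  Suppose the centre letter c also
-- occurred in R, and take its first occurrence: R = y ++ c ∷ v with c ∉ y.
-- Then p contains the factor z = c y c.  This factor is not a palindrome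
-- (otherwise reverse y = y and p contains the square (cy)(cy)), and every
-- palindromic suffix of z other than z itself is empty or the letter c, both
-- of which already occur in c y.  Appending the last c to c y therefore
-- creates no new palindrome, so z has at most |z| palindromic factors.
-- Since each further letter adds at most one new palindrome, the same
-- deficiency propagates from z to p, contradicting richness of p.

open import Defs
open import Data.List using (List; []; _∷_; length; lookup; _++_; reverse; [_]; _∷ʳ_)
open import Data.List.Properties using (++-assoc; ++-identityʳ; ++-conicalˡ; ++-conicalʳ; ∷-injective; ∷ʳ-injective; ∷ʳ-injectiveˡ; ∷ʳ-++; reverse-++; reverse-involutive; unfold-reverse; length-++; length-reverse)
open import Data.List.Reverse using (reverseView; []; _∶_∶ʳ_)
open import Data.List.Relation.Unary.All as All using (All; []; _∷_)
open import Data.List.Relation.Unary.Any as Any using (here; there)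
open import Data.List.Relation.Unary.Any.Properties using (reverse⁻)
open import Data.List.Relation.Unary.Unique.Propositional using (Unique)
open import Data.List.Relation.Unary.AllPairs using ([]; _∷_)
open import Data.List.Relation.Binary.Sublist.Propositional as Sublist using (_⊆_; ⊆-refl)
open import Data.List.Relation.Binary.Sublist.Propositional.Properties using (All-resp-⊆)
open import Data.List.Membership.Propositional using (_∈_; _∉_)
open import Data.List.Membership.Propositional.Properties using (∈-++⁺ʳ)
open import Data.Nat using (ℕ; zero; suc; _+_; _≤_; _<_; s≤s; z≤n; _≤?_)
open import Data.Nat.Properties using (suc-injective; ≤-refl; ≤-trans; ≤-total; <-cmp; +-suc; +-comm; +-identityʳ; 1+n≰n)
open import Data.Fin using (Fin; toℕ; zero; suc)
open import Data.Fin.Properties using (toℕ-injective)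
open import Data.Product using (Σ; ∃; ∃₂; _×_; _,_; proj₁; proj₂)
open import Data.Sum using (_⊎_; inj₁; inj₂; [_,_]′)
open import Data.Empty using (⊥)
open import Function using (id)
open import Relation.Binary using (tri<; tri≈; tri>)
open import Relation.Nullary using (¬_; Dec; yes; no; contradiction)
open import Relation.Nullary.Decidable using (decidable-stable; ¬¬-excluded-middle)
open import Relation.Nullary.Negation using (¬¬-Monad; ¬¬-map)
open import Relation.Binary.PropositionalEquality using (_≡_; _≢_; refl; sym; trans; cong; subst; subst₂; cong₂; module ≡-Reasoning)

open ≡-Reasoning

even-or-odd : ∀ n → ∃ λ k → n ≡ k + k ⊎ n ≡ suc (k + k)
even-or-odd zero = 0 , inj₁ refl
even-or-odd (suc n) with even-or-odd n
... | k , inj₁ even = k , inj₂ (cong suc even)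
... | k , inj₂ odd  = suc k , inj₁ (cong suc (trans odd (sym (+-suc k k))))

-- Counting with an exceptional element: in a duplicate-free list whose members
-- satisfy P or Q, where at most one value satisfies Q, all but at most one
-- member satisfy P.  (Stated for a sublist so that freshness is inherited.)
module _ {X : Set} {P Q : X → Set} (Q-unique : ∀ {x y} → Q x → Q y → x ≡ y) where

  drop-exception : ∀ {L} → Unique L → All (λ x → P x ⊎ Q x) L →
    Σ (List X) λ L′ → L′ ⊆ L × Unique L′ × All P L′ × length L ≤ suc (length L′)
  drop-exception [] [] = [] , Sublist.[] , [] , [] , z≤n
  drop-exception {x ∷ xs} (x∉xs ∷ uniq) (inj₂ qx ∷ rest) =
    xs , x Sublist.∷ʳ ⊆-refl , uniq , All.zipWith onlyP (x∉xs , rest) , ≤-refl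
    where
    onlyP : ∀ {y} → x ≢ y × (P y ⊎ Q y) → P y
    onlyP (x≢y , py⊎qy) = [ id , (λ qy → contradiction (Q-unique qx qy) x≢y) ]′ py⊎qy
  drop-exception (x∉xs ∷ uniq) (inj₁ px ∷ rest) with L′ , sub , uniq′ , allP , len ← drop-exception uniq rest =
    _ ∷ L′ , refl Sublist.∷ sub , All-resp-⊆ sub x∉xs ∷ uniq′ , px ∷ allP , s≤s len

module _ {A : Set} where

  ++-equal-length : ∀ (xs ys zs ws : List A) → xs ++ ys ≡ zs ++ ws → length xs ≡ length zs →
                    xs ≡ zs × ys ≡ ws
  ++-equal-length []       ys []       ws eq _ = refl , eq
  ++-equal-length (x ∷ xs) ys (z ∷ zs) ws eq len
    with refl , eq′ ← ∷-injective eq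
    with refl , refl ← ++-equal-length xs ys zs ws eq′ (suc-injective len)
    = refl , refl

  ++-split : ∀ (xs ys zs ws : List A) → xs ++ ys ≡ zs ++ ws → length xs ≤ length zs →
             ∃ λ h → zs ≡ xs ++ h × ys ≡ h ++ ws
  ++-split []       ys zs       ws eq _ = zs , refl , eq
  ++-split (x ∷ xs) ys (z ∷ zs) ws eq (s≤s xs≤zs)
    with refl , eq′ ← ∷-injective eq
    with h , refl , refl ← ++-split xs ys zs ws eq′ xs≤zs
    = h , refl , refl

  split-at : ∀ m {n} (w : List A) → length w ≡ m + n →
          ∃₂ λ L R → w ≡ L ++ R × length L ≡ m × length R ≡ n
  split-at zero    w       len = [] , w , refl , refl , len
  split-at (suc m) (x ∷ w) len with L , R , eq , |L| , |R| ← split-at m w (suc-injective len) =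
    x ∷ L , R , cong (x ∷_) eq , cong suc |L| , |R|

  lookup-occurrence : ∀ (w : List A) (i : Fin (length w)) →
                      ∃₂ λ u v → w ≡ u ++ lookup w i ∷ v × length u ≡ toℕ i
  lookup-occurrence (x ∷ w) zero    = [] , w , refl , refl
  lookup-occurrence (x ∷ w) (suc i) with u , v , eq , len ← lookup-occurrence w i =
    x ∷ u , v , cong (x ∷_) eq , cong suc len

  earlier-occurrence : ∀ (u v u′ v′ : List A) {a b} → u ++ a ∷ v ≡ u′ ++ b ∷ v′ →
                       length u < length u′ → a ∈ u′
  earlier-occurrence []      v (_ ∷ u′) v′ eq _          = here (proj₁ (∷-injective eq))
  earlier-occurrence (_ ∷ u) v (_ ∷ u′) v′ eq (s≤s u<u′) =
    there (earlier-occurrence u v u′ v′ (proj₂ (∷-injective eq)) u<u′)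

  later-occurrence : ∀ (u v u′ v′ : List A) {a b} → u ++ a ∷ v ≡ u′ ++ b ∷ v′ →
                     length u < length u′ → b ∈ v
  later-occurrence []      v (_ ∷ u′) v′ eq _          =
    subst (_ ∈_) (sym (proj₂ (∷-injective eq))) (∈-++⁺ʳ u′ (here refl))
  later-occurrence (_ ∷ u) v (_ ∷ u′) v′ eq (s≤s u<u′) =
    later-occurrence u v u′ v′ (proj₂ (∷-injective eq)) u<u′

  first-occurrence : ∀ {x : A} {xs} → x ∈ xs → ¬ ¬ (∃₂ λ y v → xs ≡ y ++ x ∷ v × x ∉ y)
  first-occurrence {x} {z ∷ zs} x∈ found = ¬¬-excluded-middle {A = x ≡ z} λ where
    (yes refl) → found ([] , zs , refl , λ ())
    (no x≢z)   → first-occurrence (Any.tail x≢z x∈) λ (y , v , eq , x∉y) →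
      found (z ∷ y , v , cong (z ∷_) eq , λ { (here x≡z) → x≢z x≡z ; (there x∈y) → x∉y x∈y })

  reverse-around : ∀ u (c : A) v → reverse (u ++ c ∷ v) ≡ reverse v ++ c ∷ reverse u
  reverse-around u c v = begin
    reverse (u ++ c ∷ v)        ≡⟨ reverse-++ u (c ∷ v) ⟩
    reverse (c ∷ v) ++ reverse u ≡⟨ cong (_++ reverse u) (unfold-reverse c v) ⟩
    reverse v ∷ʳ c ++ reverse u  ≡⟨ ∷ʳ-++ (reverse v) c (reverse u) ⟩
    reverse v ++ c ∷ reverse u   ∎

  palindrome-inner : ∀ b s c → Palindrome (b ∷ s ∷ʳ c) → b ≡ c × Palindrome s
  palindrome-inner b s c pal with c≡b , rev-s∷ʳb≡s∷ʳc ← ∷-injective (trans (sym (reverse-around (b ∷ s) c [])) pal)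
    = sym c≡b , ∷ʳ-injectiveˡ (reverse s) s (trans (sym (unfold-reverse b s)) rev-s∷ʳb≡s∷ʳc)

  palindrome-mirror : ∀ L M R → Palindrome (L ++ M ++ R) → length L ≡ length R → L ≡ reverse R
  palindrome-mirror L M R pal len =
    sym (proj₁ (++-equal-length (reverse R) _ L _ mirrored (trans (length-reverse R) (sym len))))
    where
    mirrored : reverse R ++ (reverse M ++ reverse L) ≡ L ++ M ++ R
    mirrored = begin
      reverse R ++ (reverse M ++ reverse L) ≡⟨ ++-assoc (reverse R) (reverse M) (reverse L) ⟨
      (reverse R ++ reverse M) ++ reverse L ≡⟨ cong (_++ reverse L) (reverse-++ M R) ⟨
      reverse (M ++ R) ++ reverse L         ≡⟨ reverse-++ L (M ++ R) ⟨
      reverse (L ++ M ++ R)                 ≡⟨ pal ⟩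
      L ++ M ++ R                           ∎

  PalFactor : List A → List A → Set
  PalFactor w f = Factor f w × Palindrome f

  Suffix : List A → List A → Set
  Suffix s w = ∃ λ t → t ++ s ≡ w

  factor-reverse : ∀ {f w : List A} → Factor f w → Factor (reverse f) (reverse w)
  factor-reverse {f} (u , v , refl) = reverse v , reverse u , (begin
    reverse v ++ reverse f ++ reverse u   ≡⟨ ++-assoc (reverse v) (reverse f) (reverse u) ⟨
    (reverse v ++ reverse f) ++ reverse u ≡⟨ cong (_++ reverse u) (reverse-++ f v) ⟨
    reverse (f ++ v) ++ reverse u         ≡⟨ reverse-++ u (f ++ v) ⟨
    reverse (u ++ f ++ v)                 ∎)

  factor-snoc : ∀ {f w : List A} {a} → Factor f (w ∷ʳ a) → Suffix f (w ∷ʳ a) ⊎ Factor f w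
  factor-snoc {f} {w} {a} (u , v , eq) with reverseView v
  ... | []           = inj₁ (u , trans (cong (u ++_) (sym (++-identityʳ f))) eq)
  ... | v′ ∶ _ ∶ʳ b = inj₂ (u , v′ , ∷ʳ-injectiveˡ (u ++ f ++ v′) w (begin
    (u ++ f ++ v′) ∷ʳ b  ≡⟨ ++-assoc u (f ++ v′) [ b ] ⟩
    u ++ (f ++ v′) ∷ʳ b  ≡⟨ cong (u ++_) (++-assoc f v′ [ b ]) ⟩
    u ++ f ++ v′ ∷ʳ b    ≡⟨ eq ⟩
    w ∷ʳ a               ∎))

  NewPalSuffix : List A → A → List A → Set
  NewPalSuffix w a f = Suffix f (w ∷ʳ a) × Palindrome f × ¬ Factor f w

  -- If g is a palindromic proper suffix of a palindromic suffix f of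
  -- w ∷ʳ a, then g is also a prefix of f, hence a factor of w.
  inner-palindrome-occurs : ∀ {w : List A} {a : A} {t g : List A} {b : A} {h : List A} →
                            t ++ (b ∷ h) ++ g ≡ w ∷ʳ a →
                            Palindrome ((b ∷ h) ++ g) → Palindrome g → Factor g w
  inner-palindrome-occurs {w} {a} {t} {g} {b} {h} suffix palf palg =
    t , reverse h , ∷ʳ-injectiveˡ (t ++ g ++ reverse h) w (begin
      (t ++ g ++ reverse h) ∷ʳ b  ≡⟨ ++-assoc t (g ++ reverse h) [ b ] ⟩
      t ++ (g ++ reverse h) ∷ʳ b  ≡⟨ cong (t ++_) (++-assoc g (reverse h) [ b ]) ⟩
      t ++ g ++ reverse h ∷ʳ b    ≡⟨ cong (λ r → t ++ g ++ r) (unfold-reverse b h) ⟨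
      t ++ g ++ reverse (b ∷ h)   ≡⟨ cong (t ++_) mirrored ⟩
      t ++ (b ∷ h) ++ g           ≡⟨ suffix ⟩
      w ∷ʳ a                      ∎)
    where
    mirrored : g ++ reverse (b ∷ h) ≡ (b ∷ h) ++ g
    mirrored = begin
      g ++ reverse (b ∷ h)         ≡⟨ cong (_++ reverse (b ∷ h)) palg ⟨
      reverse g ++ reverse (b ∷ h) ≡⟨ reverse-++ (b ∷ h) g ⟨
      reverse ((b ∷ h) ++ g)       ≡⟨ palf ⟩
      (b ∷ h) ++ g                 ∎

  -- Of two new palindromic suffixes, the one starting later is a proper
  -- suffix of the other unless they are equal; it cannot be proper, since it
  -- would then occur in w.
  nested-new-pal-suffixes : ∀ {w a f g} (nf : NewPalSuffix w a f) (ng : NewPalSuffix w a g) →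
                            length (proj₁ (proj₁ nf)) ≤ length (proj₁ (proj₁ ng)) → f ≡ g
  nested-new-pal-suffixes ((t , sf) , pf , _) ((t′ , sg) , pg , new-g) t≤t′
    with ++-split t _ t′ _ (trans sf (sym sg)) t≤t′
  ... | []    , _    , f≡g  = f≡g
  ... | b ∷ h , refl , refl = contradiction (inner-palindrome-occurs sf pf pg) new-g

  -- Hence appending a letter creates at most one new palindrome.
  new-pal-suffix-unique : ∀ {w a f g} → NewPalSuffix w a f → NewPalSuffix w a g → f ≡ g
  new-pal-suffix-unique nf ng with ≤-total (length (proj₁ (proj₁ nf))) (length (proj₁ (proj₁ ng)))
  ... | inj₁ t≤t′ = nested-new-pal-suffixes nf ng t≤t′
  ... | inj₂ t′≤t = sym (nested-new-pal-suffixes ng nf t′≤t)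

  classify : ∀ {w a f} → PalFactor (w ∷ʳ a) f → ¬ ¬ (PalFactor w f ⊎ NewPalSuffix w a f)
  classify {w} {a} {f} (fac , pal) = ¬¬-map split ¬¬-excluded-middle
    where
    split : Dec (Factor f w) → PalFactor w f ⊎ NewPalSuffix w a f
    split (yes old) = inj₁ (old , pal)
    split (no new)  = inj₂ ([ id , (λ old → contradiction old new) ]′ (factor-snoc fac) , pal , new)

  -- PalBound w B: every duplicate-free list of palindromic factors of w has
  -- length at most B, i.e. w has at most B distinct palindromic factors.
  PalBound : List A → ℕ → Set
  PalBound w B = ∀ L → Unique L → All (PalFactor w) L → length L ≤ B

  factor-[] : ∀ {f : List A} → Factor f [] → f ≡ []
  factor-[] {f} (u , v , eq) = ++-conicalˡ f v (++-conicalʳ u (f ++ v) eq)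

  palBound-[] : PalBound [] 1
  palBound-[] []          _                  _ = z≤n
  palBound-[] (_ ∷ [])    _                  _ = s≤s z≤n
  palBound-[] (_ ∷ _ ∷ _) ((f≢g ∷ _) ∷ _) ((f∈[] , _) ∷ (g∈[] , _) ∷ _) =
    contradiction (trans (factor-[] f∈[]) (sym (factor-[] g∈[]))) f≢g

  -- Palindromic factors of reverse w are palindromic factors of w.
  palBound-reverse : ∀ {w B} → PalBound w B → PalBound (reverse w) B
  palBound-reverse {w} bound L uniq pals = bound L uniq (All.map unreverse pals)
    where
    unreverse : ∀ {f} → PalFactor (reverse w) f → PalFactor w f
    unreverse (fac , pal) = subst₂ Factor pal (reverse-involutive w) (factor-reverse fac) , pal

  palBound-snoc : ∀ {w a B} → PalBound w B → PalBound (w ∷ʳ a) (suc B)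
  palBound-snoc {w} {a} {B} bound L uniq pals = decidable-stable (length L ≤? suc B) λ L≰ →
    All.mapM _ ¬¬-Monad classify pals λ classified →
      let L′ , _ , uniq′ , pals′ , L≤ = drop-exception new-pal-suffix-unique uniq classified
      in L≰ (≤-trans L≤ (s≤s (bound L′ uniq′ pals′)))

  palBound-snoc-old : ∀ {w a B} → (∀ s → Suffix s (w ∷ʳ a) → Palindrome s → Factor s w) →
                      PalBound w B → PalBound (w ∷ʳ a) B
  palBound-snoc-old {w} {a} old bound L uniq pals = bound L uniq (All.map shrink pals)
    where
    shrink : ∀ {f} → PalFactor (w ∷ʳ a) f → PalFactor w f
    shrink (fac , pal) = [ (λ suffix → old _ suffix pal) , id ]′ (factor-snoc fac) , pal

  palBound-append : ∀ {w B} β → PalBound w B → PalBound (w ++ β) (B + length β)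
  palBound-append {w} {B} []      bound =
    subst₂ PalBound (sym (++-identityʳ w)) (sym (+-identityʳ B)) bound
  palBound-append {w} {B} (a ∷ β) bound =
    subst₂ PalBound (++-assoc w [ a ] β) (sym (+-suc B (length β))) (palBound-append β (palBound-snoc bound))

  palBound-length : ∀ w → PalBound w (suc (length w))
  palBound-length w = palBound-append w palBound-[]

  Deficient : List A → Set
  Deficient w = PalBound w (length w)

  rich-not-deficient : ∀ {w} → Rich w → ¬ Deficient w
  rich-not-deficient {w} (L , uniq , pals , _ , len) bound =
    1+n≰n (subst (_≤ length w) len (bound L uniq pals))

  deficient-snoc-old : ∀ {w a} → (∀ s → Suffix s (w ∷ʳ a) → Palindrome s → Factor s w) →
                       Deficient (w ∷ʳ a)
  deficient-snoc-old {w} old = subst (PalBound _) (sym (trans (length-++ w) (+-comm (length w) 1)))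
    (palBound-snoc-old old (palBound-length w))

  deficient-append : ∀ {w} β → Deficient w → Deficient (w ++ β)
  deficient-append {w} β d = subst (PalBound (w ++ β)) (sym (length-++ w)) (palBound-append β d)

  deficient-reverse : ∀ {w} → Deficient w → Deficient (reverse w)
  deficient-reverse {w} d = subst (PalBound (reverse w)) (sym (length-reverse w)) (palBound-reverse d)

  deficient-infix : ∀ {w} α β → Deficient w → Deficient (α ++ w ++ β)
  deficient-infix {w} α β d = subst Deficient reversed-twice
    (deficient-reverse (deficient-append (reverse α) (deficient-reverse (deficient-append β d))))
    where
    reversed-twice : reverse (reverse (w ++ β) ++ reverse α) ≡ α ++ w ++ β
    reversed-twice = begin
      reverse (reverse (w ++ β) ++ reverse α)           ≡⟨ reverse-++ (reverse (w ++ β)) (reverse α) ⟩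
      reverse (reverse α) ++ reverse (reverse (w ++ β)) ≡⟨ cong₂ _++_ (reverse-involutive α) (reverse-involutive (w ++ β)) ⟩
      α ++ w ++ β                                       ∎

  centred : A → List A → List A
  centred c R = reverse R ++ c ∷ R

  palindrome-halves : ∀ {p k} → Palindrome p → length p ≡ k + k → ∃ λ R → p ≡ reverse R ++ R
  palindrome-halves {p} {k} pal len with L , R , refl , |L| , |R| ← split-at k p len =
    R , cong (_++ R) (palindrome-mirror L [] R pal (trans |L| (sym |R|)))

  palindrome-centre : ∀ {p k} → Palindrome p → length p ≡ suc (k + k) →
                      ∃₂ λ c R → p ≡ centred c R × length R ≡ k
  palindrome-centre {p} {k} pal len with split-at k p (trans len (sym (+-suc k k)))
  ... | L , c ∷ R , refl , |L| , |cR| =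
    c , R , cong (_++ c ∷ R) (palindrome-mirror L [ c ] R pal (trans |L| (sym (suc-injective |cR|)))) ,
    suc-injective |cR|

  -- A square-free palindrome of even length is empty: otherwise its two
  -- central letters form a square aa.
  even-palindrome-empty : ∀ {p k} → Palindrome p → SquareFree p → length p ≡ k + k → p ≡ []
  even-palindrome-empty {k = k} pal sf len with palindrome-halves {k = k} pal len
  ... | []    , refl = refl
  ... | a ∷ R , refl = contradiction (sf [ a ] (reverse R , R , sym centre-square)) λ ()
    where
    centre-square : reverse (a ∷ R) ++ a ∷ R ≡ reverse R ++ a ∷ a ∷ R
    centre-square = trans (cong (_++ a ∷ R) (unfold-reverse a R)) (∷ʳ-++ (reverse R) a (a ∷ R))

  centre-letter : ∀ {c R} (mid : Fin (length (centred c R))) → toℕ mid ≡ length R →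
                  lookup (centred c R) mid ≡ c
  centre-letter {c = c} {R = R} mid mid≡ with u , v , eq , |u| ← lookup-occurrence (centred c R) mid =
    sym (proj₁ (∷-injective (proj₂ (++-equal-length (reverse R) _ u _ eq
      (trans (length-reverse R) (trans (sym mid≡) (sym |u|)))))))

  -- If c does not occur in y, the only palindromic suffixes of y ∷ʳ c are
  -- the empty word and c itself: a longer one would begin with c inside y.
  short-palindromic-suffix : ∀ {c : A} {y t s} → c ∉ y → t ++ s ≡ y ∷ʳ c → Palindrome s →
                             s ≡ [] ⊎ s ≡ [ c ]
  short-palindromic-suffix {c} {y} {t} {s} c∉y eq pal with reverseView s
  ... | []             = inj₁ refl
  ... | s′ ∶ _ ∶ʳ d
    with t++s′≡y , refl ← ∷ʳ-injective (t ++ s′) y (trans (++-assoc t s′ [ d ]) eq)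
    with s′
  ... | []     = inj₂ refl
  ... | b ∷ s″ = contradiction (subst (c ∈_) t++s′≡y (∈-++⁺ʳ t (here c≡b))) c∉y
    where
    c≡b : c ≡ b
    c≡b = sym (proj₁ (palindrome-inner b s″ c pal))

  -- The heart of the proof: if the centre letter c of a square-free word
  -- centred c (y ++ c ∷ v) reappears, with no c in between, then the factor
  -- c y c shows that the word is deficient, so it is not rich.
  nearest-repeat : ∀ {c : A} {y v} → Rich (centred c (y ++ c ∷ v)) → SquareFree (centred c (y ++ c ∷ v)) →
                   c ∉ y → ⊥
  nearest-repeat {c} {y} {v} rich sf c∉y =
    rich-not-deficient rich (subst Deficient (sym around-cyc) (deficient-infix (reverse v ++ c ∷ reverse y) v cyc-deficient))
    where
    layout : centred c (y ++ c ∷ v) ≡ reverse v ++ c ∷ reverse y ++ c ∷ y ++ c ∷ v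
    layout = begin
      reverse (y ++ c ∷ v) ++ c ∷ y ++ c ∷ v        ≡⟨ cong (_++ c ∷ y ++ c ∷ v) (reverse-around y c v) ⟩
      (reverse v ++ c ∷ reverse y) ++ c ∷ y ++ c ∷ v ≡⟨ ++-assoc (reverse v) (c ∷ reverse y) (c ∷ y ++ c ∷ v) ⟩
      reverse v ++ c ∷ reverse y ++ c ∷ y ++ c ∷ v   ∎

    around-cyc : centred c (y ++ c ∷ v) ≡ (reverse v ++ c ∷ reverse y) ++ (c ∷ y ∷ʳ c) ++ v
    around-cyc = begin
      centred c (y ++ c ∷ v)                           ≡⟨ layout ⟩
      reverse v ++ c ∷ reverse y ++ c ∷ y ++ c ∷ v     ≡⟨ ++-assoc (reverse v) (c ∷ reverse y) (c ∷ y ++ c ∷ v) ⟨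
      (reverse v ++ c ∷ reverse y) ++ c ∷ y ++ c ∷ v   ≡⟨ cong ((reverse v ++ c ∷ reverse y) ++_) (∷ʳ-++ (c ∷ y) c v) ⟨
      (reverse v ++ c ∷ reverse y) ++ (c ∷ y ∷ʳ c) ++ v ∎

    -- If y were a palindrome, the word would contain the square (cy)(cy).
    y-not-palindrome : ¬ Palindrome y
    y-not-palindrome pal with () ← sf (c ∷ y) (reverse v , c ∷ v , sym (begin
      centred c (y ++ c ∷ v)                         ≡⟨ layout ⟩
      reverse v ++ c ∷ reverse y ++ c ∷ y ++ c ∷ v   ≡⟨ cong (λ r → reverse v ++ c ∷ r ++ c ∷ y ++ c ∷ v) pal ⟩
      reverse v ++ (c ∷ y) ++ (c ∷ y) ++ c ∷ v       ≡⟨ cong (reverse v ++_) (++-assoc (c ∷ y) (c ∷ y) (c ∷ v)) ⟨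
      reverse v ++ ((c ∷ y) ++ (c ∷ y)) ++ c ∷ v     ∎))

    old-suffixes : ∀ s → Suffix s (c ∷ y ∷ʳ c) → Palindrome s → Factor s (c ∷ y)
    old-suffixes s ([] , refl) pal = contradiction (proj₂ (palindrome-inner c y c pal)) y-not-palindrome
    old-suffixes s (_ ∷ t , eq) pal with short-palindromic-suffix c∉y (proj₂ (∷-injective eq)) pal
    ... | inj₁ refl = [] , c ∷ y , refl
    ... | inj₂ refl = [] , y , refl

    cyc-deficient : Deficient (c ∷ y ∷ʳ c)
    cyc-deficient = deficient-snoc-old old-suffixes

  centre-letter-not-in-arm : ∀ {c : A} {R} → Rich (centred c R) → SquareFree (centred c R) → c ∉ R
  centre-letter-not-in-arm rich sf c∈R =
    first-occurrence c∈R λ { (y , v , refl , c∉y) → nearest-repeat rich sf c∉y }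

  -- Hence c occurs in centred c R only at the centre: an occurrence further
  -- left or further right would put c into reverse R or into R.
  centre-occurrence-unique : ∀ {c : A} {R u v} → Rich (centred c R) → SquareFree (centred c R) →
                             centred c R ≡ u ++ c ∷ v → length u ≡ length R
  centre-occurrence-unique {c} {R} {u} {v} rich sf occ with <-cmp (length u) (length R)
  ... | tri≈ _ same _ = same
  ... | tri< before _ _ = contradiction
    (reverse⁻ (earlier-occurrence u v (reverse R) R (sym occ) (subst (length u <_) (sym (length-reverse R)) before)))
    (centre-letter-not-in-arm rich sf)
  ... | tri> _ _ after = contradiction
    (later-occurrence (reverse R) R u v occ (subst (_< length u) (sym (length-reverse R)) after))
    (centre-letter-not-in-arm rich sf)

  centre-position-unique : ∀ {c : A} {R} → Rich (centred c R) → SquareFree (centred c R) →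
                           (i : Fin (length (centred c R))) → lookup (centred c R) i ≡ c → toℕ i ≡ length R
  centre-position-unique {c} {R} rich sf i at-i≡c with u , v , at-i , |u| ← lookup-occurrence (centred c R) i =
    trans (sym |u|) (centre-occurrence-unique rich sf (trans at-i (cong (λ x → u ++ x ∷ v) at-i≡c)))

lemma2p6 : {A : Set} (p : List A) → p ≢ [] → Palindrome p → Rich p → SquareFree p →
    Σ ℕ λ k → length p ≡ suc (k + k) ×
      ((mid : Fin (length p)) → toℕ mid ≡ k →
        (i : Fin (length p)) → lookup p i ≡ lookup p mid → i ≡ mid)
lemma2p6 p p≢[] pal rich sf with even-or-odd (length p)
... | k , inj₁ even = contradiction (even-palindrome-empty {k = k} pal sf even) p≢[]
... | k , inj₂ odd with palindrome-centre {k = k} pal odd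
... | c , R , refl , |R| = k , odd , λ mid mid≡k i same →
  let mid-is-c = centre-letter {c = c} {R = R} mid (trans mid≡k (sym |R|))
  in toℕ-injective (begin
    toℕ i    ≡⟨ centre-position-unique {c = c} {R = R} rich sf i (trans same mid-is-c) ⟩
    length R ≡⟨ |R| ⟩
    k        ≡⟨ mid≡k ⟨
    toℕ mid  ∎)
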